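{- For integers $C\geq 3$, $L\geq 3$ and $k\in\{1,\dots,C-2\}$, $\gamma_{P,k}(WKP_{(C,L)})\leq (C-k-1)C^{L-2}$.
   Context: For a graph $G$, $S\subseteq V(G)$ and an integer $k\ge 0$, define $\mathcal{P}^0_{G,k}(S)=N_G[S]$ (closed neighbourhood of $S$) and $\mathcal{P}^{i+1}_{G,k}(S)=\bigcup\{N_G[v] : v\in \mathcal{P}^i_{G,k}(S),\ |N_G[v]\setminus \mathcal{P}^i_{G,k}(S)|\le k\}$. These sets increase and stabilize at a set $\mathcal{P}^\infty_{G,k}(S)$. A $k$-power dominating set ($k$-PDS) is a set $S$ with $\mathcal{P}^\infty_{G,k}(S)=V(G)$, and $\gamma_{P,k}(G)$ is the minimum cardinality of a $k$-PDS of $G$. Let $[C]_0=\{0,\dots,C-1\}$. The WK-Pyramid network $WKP_{(C,L)}$ has vertex set $\{(r,(a_r a_{r-1}\cdots a_1)) : r\in\{1,\dots,L\},\ a_i\in[C]_0\}\cup\{(0,(1))\}$; a vertex $(r,(a_r\cdots a_1))$ is said to be at level $r$. The vertex $(0,(1))$ is adjacent to every vertex at level $1$. A vertex $(r,(a_r\cdots a_1))$ with $r>0$ is adjacent to: (1) the vertices $(r,(a_r\cdots a_2 b))$ with $b\in[C]_0$, $b\ne a_1$; (2) the vertex $(r,(a_r\cdots a_{j+1}a_{j-1}(a_j)^{j-1}))$ if there is a $j$ with $2\le j\le r$, $a_{j-1}=a_{j-2}=\cdots=a_1$ and $a_j\ne a_{j-1}$, where $(a_j)^{j-1}$ denotes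 $a_j$ repeated $j-1$ times; (3) the vertices $(r+1,(a_r\cdots a_1 b))$ for $b\in[C]_0$ (when $r<L$); (4) the vertex $(r-1,(a_r\cdots a_2))$ (for $r=1$ this is $(0,(1))$). -}

module Defs where

open import Data.Nat using (ℕ; zero; suc; _≤_)
open import Data.Fin using (Fin)
open import Data.List using (List; []; _∷_; length; replicate; _++_)
open import Data.List.Membership.Propositional using (_∈_)
open import Data.Product using (Σ; ∃; ∃-syntax; _×_; _,_)
open import Data.Sum using (_⊎_)
open import Relation.Nullary using (¬_)
open import Relation.Binary.PropositionalEquality using (_≡_; _≢_)

-- A vertex (r,(a_r a_{r-1} ... a_1)) with 1 ≤ r ≤ L is represented by the list
-- a_1 ∷ a_2 ∷ ... ∷ a_r ∷ []  (least significant digit a_1 FIRST), so that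
-- appending a digit b (going to level r+1: a_r...a_1 b) is  b ∷ w  and the
-- parent (a_r...a_2) is the tail.  The vertex (0,(1)) is  apex.
data Vertex (C L : ℕ) : Set where
  apex : Vertex C L
  node : (w : List (Fin C)) → 1 ≤ length w → length w ≤ L → Vertex C L

data Adj {C L : ℕ} : Vertex C L → Vertex C L → Set where
  -- (0,(1)) adjacent to every level-1 vertex, and rule (4) for r = 1
  apex-down : ∀ {b p q} → Adj apex (node (b ∷ []) p q)
  apex-up   : ∀ {b p q} → Adj (node (b ∷ []) p q) apex
  sibling   : ∀ {a b w p q p' q'} → a ≢ b →
              Adj (node (a ∷ w) p q) (node (b ∷ w) p' q')
  -- rule (2): a_r..a_{j+1} a_j (a_{j-1})^{j-1}  ~  a_r..a_{j+1} a_{j-1} (a_j)^{j-1},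
  -- here with m = j-1 ≥ 1, x = a_{j-1} = ... = a_1, y = a_j ≠ x
  swap      : ∀ {m x y w p q p' q'} → 1 ≤ m → x ≢ y →
              Adj (node (replicate m x ++ y ∷ w) p q)
                  (node (replicate m y ++ x ∷ w) p' q')
  child     : ∀ {b w p q p' q'} →
              Adj (node w p q) (node (b ∷ w) p' q')
  parent    : ∀ {b w p q p' q'} →
              Adj (node (b ∷ w) p q) (node w p' q')

InN : ∀ {C L} → Vertex C L → Vertex C L → Set
InN u v = u ≡ v ⊎ Adj u v

-- "|N[u] \ P| ≤ k": the vertices of N[u] outside P are all contained in
-- some list of length ≤ k.
SmallOutside : ∀ {C L} → ℕ → (Vertex C L → Set) → Vertex C L → Set
SmallOutside {C} {L} k P u =
  ∃[ ws ] (length ws ≤ k × (∀ (w : Vertex C L) → InN u w → ¬ P w → w ∈ ws))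

Pow : ∀ {C L} → ℕ → List (Vertex C L) → ℕ → Vertex C L → Set
Pow k S zero v = ∃[ s ] (s ∈ S × InN s v)
Pow k S (suc i) v = ∃[ u ] (Pow k S i u × SmallOutside k (Pow k S i) u × InN u v)

IsKPDS : (C L k : ℕ) → List (Vertex C L) → Set
IsKPDS C L k S = ∃[ i ] (∀ (v : Vertex C L) → Pow k S i v)

-- Below every vertex x of level L−2 with last digit e, put into S the children x d with
-- d ∈ {e+k+1, …, e+C−1} (digits mod C): these are (C−k−1)·C^(L−2) vertices, and N[S]
-- contains the levels L−2 and L−1 and every leaf x a d with d chosen.  The key point is that
-- a leaf whose siblings and parent are observed has exactly one further neighbour, its
-- partner under rule (2), which it therefore forces.  This forces in turn the leaves x a d
-- (d chosen), the leaf x (e+1) (e+1) (partner of a leaf below the vertex with last digit e+1,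
-- for which e is chosen), then all children of x (e+1), then every leaf x a (e+1).  Now each
-- vertex x a of level L−1 has at most k unobserved children, those with digit in
-- {e, e+2, …, e+k}, and forces them.  Finally the levels above L−2 and the apex are forced
-- one level at a time, each vertex by one of its children.

module Submission where

open import Defs
open import Data.Nat
  using (ℕ; zero; suc; _+_; _*_; _∸_; _^_; _≤_; _<_; _≤′_; ≤′-refl; ≤′-step; z≤n; s≤s; NonZero; _%_; _<?_)
open import Data.Nat.Properties
  using ( ≤-refl; ≤-reflexive; ≤-pred; ≤-trans; ≤-antisym; ≤-irrelevant; ≡-irrelevant; <⇒≤; ≮⇒≥
        ; n≤1+n; 1+n≰n; 1+n≢n; m≤n⇒m<n∨m≡n; ≤⇒≤′; m≤m+n; m≤o∸n⇒m+n≤o; m+[n∸m]≡n; m∸n+n≡m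
        ; m<n+o⇒m∸n<o; +-comm; +-assoc; +-suc; +-identityʳ; *-comm; +-cancelˡ-≡; suc-injective )
open import Data.Nat.DivMod using (_mod_; m%n<n; m%n%n≡m%n; %-distribˡ-+; [m+n]%n≡m%n; m<n⇒m%n≡m; n%n≡0)
open import Data.Fin using (Fin; toℕ; fromℕ<)
open import Data.Fin.Properties using (toℕ-fromℕ<; toℕ-injective; toℕ<n) renaming (_≟_ to _≟ᶠ_)
open import Data.List using (List; []; _∷_; [_]; length; replicate; _++_; map; concatMap; applyUpTo; allFin)
open import Data.List.Properties
  using (length-++; length-map; length-applyUpTo; length-tabulate; ++-conicalʳ; ∷-injectiveˡ; ∷-injectiveʳ)
open import Data.List.Membership.Propositional using (_∈_)
open import Data.List.Membership.Propositional.Properties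
  using (∈-map⁺; ∈-concatMap⁺; ∈-applyUpTo⁺; ∈-allFin)
open import Data.List.Relation.Unary.Any as Any using (here; there)
open import Data.Product using (Σ-syntax; ∃-syntax; _×_; _,_)
open import Data.Sum using (_⊎_; inj₁; inj₂; [_,_]′)
open import Data.Empty using (⊥-elim)
open import Function using (_∘_; id)
open import Relation.Nullary using (¬_; yes; no; contradiction)
open import Relation.Binary.PropositionalEquality
  using (_≡_; _≢_; refl; sym; trans; cong; cong₂; subst; module ≡-Reasoning)

node-≡ : ∀ {C L} {w w' : List (Fin C)} {p q p' q'} → w ≡ w' → node {C} {L} w p q ≡ node w' p' q'
node-≡ {p = p} {q} {p'} {q'} refl = cong₂ (node _) (≤-irrelevant p p') (≤-irrelevant q q')

length-swap : ∀ {A : Set} {w} m {x y : A} {z} →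
  w ≡ replicate m x ++ y ∷ z → length (replicate m y ++ x ∷ z) ≡ length w
length-swap zero refl = refl
length-swap (suc m) refl = cong suc (length-swap m refl)

swap-unique : ∀ {A : Set} {m m'} {x y x' y' : A} {z z'} → x ≢ y → x' ≢ y' →
  replicate (suc m) x ++ y ∷ z ≡ replicate (suc m') x' ++ y' ∷ z' →
  replicate (suc m) y ++ x ∷ z ≡ replicate (suc m') y' ++ x' ∷ z'
swap-unique {m = zero} {zero} _ _ refl = refl
swap-unique {m = zero} {suc m'} x≢y _ refl = ⊥-elim (x≢y refl)
swap-unique {m = suc m} {zero} _ x'≢y' refl = ⊥-elim (x'≢y' refl)
swap-unique {m = suc m} {suc m'} x≢y x'≢y' eq =
  cong₂ _∷_ (∷-injectiveˡ partners) partners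
  where
  partners = swap-unique x≢y x'≢y' (∷-injectiveʳ eq)

-- Matching on Adj at a node whose word is not a variable does not unify (the indices of
-- Adj involve replicate and ++), so the neighbours of a node are inspected through this
-- view, which records the shape of the word as an equation.
data Neighbour {C L : ℕ} (w : List (Fin C)) : Vertex C L → Set where
  nbr-apex    : ∀ {b} → w ≡ b ∷ [] → Neighbour w apex
  nbr-sibling : ∀ {a b x p q} → w ≡ a ∷ x → Neighbour w (node (b ∷ x) p q)
  nbr-swap    : ∀ {m x y z p q} → x ≢ y → w ≡ replicate (suc m) x ++ y ∷ z →
                Neighbour w (node (replicate (suc m) y ++ x ∷ z) p q)
  nbr-child   : ∀ {b p q} → Neighbour w (node (b ∷ w) p q)
  nbr-parent  : ∀ {b x p q} → w ≡ b ∷ x → Neighbour w (node x p q)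

neighbour : ∀ {C L} {w : List (Fin C)} {p q} {v : Vertex C L} → Adj (node w p q) v → Neighbour w v
neighbour apex-up = nbr-apex refl
neighbour (sibling _) = nbr-sibling refl
neighbour (swap {m = suc m} _ x≢y) = nbr-swap x≢y refl
neighbour child = nbr-child
neighbour parent = nbr-parent refl

module _ {C L k : ℕ} {S : List (Vertex C L)} where

  private
    P : ℕ → Vertex C L → Set
    P = Pow k S

  forces : ∀ i {u} (ws : List (Vertex C L)) → length ws ≤ k → P i u →
    (∀ {w} → Adj u w → P i w ⊎ w ∈ ws) → ∀ {v} → InN u v → P (suc i) v
  forces i {u} ws ws≤k Pu others u~v = u , Pu , (ws , ws≤k , outside) , u~v
    where
    outside : ∀ w → InN u w → ¬ P i w → w ∈ ws
    outside w (inj₁ refl) w∉P = contradiction Pu w∉P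
    outside w (inj₂ u~w) w∉P = [ (λ Pw → contradiction Pw w∉P) , id ]′ (others u~w)

  Pow-suc : ∀ i {v} → P i v → P (suc i) v
  Pow-suc zero (s , s∈S , s~v) =
    forces 0 [] z≤n (s , s∈S , inj₁ refl) (λ s~w → inj₁ (s , s∈S , inj₂ s~w)) s~v
  Pow-suc (suc i) (u , Pu , few , u~v) =
    forces (suc i) [] z≤n (u , Pu , few , inj₁ refl) (λ u~w → inj₁ (u , Pu , few , inj₂ u~w)) u~v

  Pow-mono : ∀ {i} j {v} → i ≤ j → P i v → P j v
  Pow-mono _ = go ∘ ≤⇒≤′
    where
    go : ∀ {i j v} → i ≤′ j → P i v → P j v
    go ≤′-refl = id
    go (≤′-step i≤′j) = Pow-suc _ ∘ go i≤′j

  module _ (1≤k : 1 ≤ k) where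

    forces-one : ∀ i {u v} → P i u → Adj u v → (∀ {w} → Adj u w → P i w ⊎ w ≡ v) → P (suc i) v
    forces-one i {v = v} Pu u~v others =
      forces i [ v ] 1≤k Pu (λ u~w → [ inj₁ , inj₂ ∘ here ]′ (others u~w)) (inj₂ u~v)

    swap-forced : ∀ i m {x y : Fin C} {z} → x ≢ y → length (x ∷ replicate m x ++ y ∷ z) ≡ L →
      (∀ b {p q} → P i (node (b ∷ replicate m x ++ y ∷ z) p q)) →
      (∀ {p q} → P i (node (replicate m x ++ y ∷ z) p q)) →
      ∀ {p q} → P (suc i) (node (replicate (suc m) y ++ x ∷ z) p q)
    swap-forced i m {x} {y} {z} x≢y leaf siblings parent′ {p} {q} =
      forces-one i {u = u} (siblings x) (swap (s≤s z≤n) x≢y) others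
      where
      u : Vertex C L
      u = node (x ∷ replicate m x ++ y ∷ z) (s≤s z≤n) (≤-reflexive leaf)
      others : ∀ {w} → Adj u w → P i w ⊎ w ≡ node (replicate (suc m) y ++ x ∷ z) p q
      others u~w with neighbour u~w
      ... | nbr-apex eq = contradiction (++-conicalʳ (replicate m x) (y ∷ z) (∷-injectiveʳ eq)) λ ()
      ... | nbr-sibling refl = inj₁ (siblings _)
      ... | nbr-swap x'≢y' eq = inj₂ (node-≡ (sym (swap-unique x≢y x'≢y' eq)))
      ... | nbr-child {q = q'} = ⊥-elim (1+n≰n (subst (λ l → suc l ≤ L) leaf q'))
      ... | nbr-parent refl = inj₁ parent′

    climb : ∀ i {r} → r < L → (∀ {w p q} → suc r ≤ length w → P i (node w p q)) →
      ∀ {w p q} → r ≤ length w → P (suc i) (node w p q)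
    climb _ _ _ {[]} {()}
    climb i {r} r<L deeper {b ∷ w} {p} {q} r≤w with m≤n⇒m<n∨m≡n r≤w
    ... | inj₁ r<w = Pow-suc i (deeper r<w)
    ... | inj₂ refl = forces-one i {u = u} (deeper ≤-refl) parent others
      where
      u : Vertex C L
      u = node (b ∷ b ∷ w) (s≤s z≤n) r<L
      others : ∀ {v} → Adj u v → P i v ⊎ v ≡ node (b ∷ w) p q
      others u~v with neighbour u~v
      ... | nbr-apex ()
      ... | nbr-sibling refl = inj₁ (deeper ≤-refl)
      ... | nbr-swap {m} _ eq = inj₁ (deeper (≤-reflexive (sym (length-swap (suc m) eq))))
      ... | nbr-child = inj₁ (deeper (n≤1+n _))
      ... | nbr-parent refl = inj₂ (node-≡ refl)

    climbs : ∀ d i {r} → r + d < L → (∀ {w p q} → r + d ≤ length w → P i (node w p q)) →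
      ∀ {w p q} → r ≤ length w → P (d + i) (node w p q)
    climbs zero i {r} _ known {w} = known ∘ subst (_≤ length w) (sym (+-identityʳ r))
    climbs (suc d) i {r} r+d<L known =
      climb (d + i) (≤-trans (s≤s (m≤m+n r (suc d))) r+d<L)
        (climbs d i (subst (_< L) (+-suc r d) r+d<L)
          (λ {w} → known ∘ subst (_≤ length w) (sym (+-suc r d))))

    apex-forced : ∀ i → Fin C → 1 ≤ L → (∀ {w p q} → P i (node w p q)) → P (suc i) apex
    apex-forced i z 1≤L all-nodes = forces-one i {u = u} all-nodes apex-up others
      where
      u : Vertex C L
      u = node (z ∷ []) (s≤s z≤n) 1≤L
      others : ∀ {v} → Adj u v → P i v ⊎ v ≡ apex
      others {apex} _ = inj₂ refl
      others {node _ _ _} _ = inj₁ all-nodes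

Word : ℕ → ℕ → Set
Word C r = Σ[ w ∈ List (Fin C) ] length w ≡ r

extensions : ∀ {C r} → Word C r → List (Word C (suc r))
extensions {C} (w , lw) = map (λ a → a ∷ w , cong suc lw) (allFin C)

words : ∀ C r → List (Word C r)
words C zero = [ [] , refl ]
words C (suc r) = concatMap extensions (words C r)

∈-words : ∀ {C r} (w : Word C r) → w ∈ words C r
∈-words {r = zero} ([] , refl) = here refl
∈-words {r = suc r} (a ∷ w , lw) =
  ∈-concatMap⁺ extensions (Any.map (λ { refl → a∷w∈ }) (∈-words w′))
  where
  w′ : Word _ r
  w′ = w , suc-injective lw
  a∷w∈ : (a ∷ w , lw) ∈ extensions w′
  a∷w∈ = subst (_∈ extensions w′) (cong (a ∷ w ,_) (≡-irrelevant _ lw))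
           (∈-map⁺ (λ b → b ∷ w , cong suc (suc-injective lw)) (∈-allFin a))

length-concatMap-const : ∀ {A B : Set} {m} (f : A → List B) → (∀ x → length (f x) ≡ m) →
  ∀ xs → length (concatMap f xs) ≡ length xs * m
length-concatMap-const f lf [] = refl
length-concatMap-const f lf (x ∷ xs) =
  trans (length-++ (f x)) (cong₂ _+_ (lf x) (length-concatMap-const f lf xs))

length-words : ∀ C r → length (words C r) ≡ C ^ r
length-words C zero = refl
length-words C (suc r) = begin
  length (concatMap extensions (words C r))
    ≡⟨ length-concatMap-const extensions length-extensions (words C r) ⟩
  length (words C r) * C
    ≡⟨ cong (_* C) (length-words C r) ⟩
  C ^ r * C
    ≡⟨ *-comm (C ^ r) C ⟩
  C ^ suc r
    ∎
  where
  open ≡-Reasoning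
  length-extensions : ∀ (w : Word C r) → length (extensions w) ≡ C
  length-extensions _ = trans (length-map _ (allFin C)) (length-tabulate id)

-- The seeds below a vertex of level L−2 with last digit e are its children with digit in
-- chosen e.
record Pattern (C k t : ℕ) : Set where
  field
    next            : Fin C → Fin C
    chosen          : Fin C → List (Fin C)
    rest            : Fin C → List (Fin C)
    ≢-next          : ∀ e → e ≢ next e
    ∈-chosen-next   : ∀ e → e ∈ chosen (next e)
    chosen-nonempty : ∀ e → ∃[ d ] d ∈ chosen e
    length-chosen   : ∀ e → length (chosen e) ≡ t
    length-rest     : ∀ e → length (rest e) ≤ k
    cover           : ∀ e c → c ∈ chosen e ⊎ c ≡ next e ⊎ c ∈ rest e

module Seeding {C k t : ℕ} (π : Pattern C k t) (1≤k : 1 ≤ k) (n : ℕ) where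
  open Pattern π

  L : ℕ
  L = 3 + n

  child-fits : ∀ {m} → m ≡ n → 2 + m ≤ L
  child-fits refl = n≤1+n _

  seed : Fin C → Fin C → (x : List (Fin C)) → length x ≡ n → Vertex C L
  seed d e x lx = node (d ∷ e ∷ x) (s≤s z≤n) (child-fits lx)

  cell-seeds : Word C (suc n) → List (Vertex C L)
  cell-seeds ([] , ())
  cell-seeds (e ∷ x , lx) = map (λ d → seed d e x (suc-injective lx)) (chosen e)

  seeds : List (Vertex C L)
  seeds = concatMap cell-seeds (words C (suc n))

  length-seeds : length seeds ≡ C ^ suc n * t
  length-seeds = begin
    length seeds                  ≡⟨ length-concatMap-const cell-seeds length-cell-seeds (words C (suc n)) ⟩
    length (words C (suc n)) * t  ≡⟨ cong (_* t) (length-words C (suc n)) ⟩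
    C ^ suc n * t                 ∎
    where
    open ≡-Reasoning
    length-cell-seeds : ∀ x → length (cell-seeds x) ≡ t
    length-cell-seeds ([] , ())
    length-cell-seeds (e ∷ _ , _) = trans (length-map _ (chosen e)) (length-chosen e)

  ∈-seeds : ∀ {d e x} → d ∈ chosen e → length x ≡ n → ∀ {p q} → node (d ∷ e ∷ x) p q ∈ seeds
  ∈-seeds {e = e} {x} d∈ lx =
    ∈-concatMap⁺ cell-seeds (Any.map (λ { refl → seed∈ }) (∈-words (e ∷ x , cong suc lx)))
    where
    seed∈ = subst (_∈ cell-seeds (e ∷ x , cong suc lx)) (node-≡ refl)
              (∈-map⁺ (λ d → seed d e x (suc-injective (cong suc lx))) d∈)

  P : ℕ → Vertex C L → Set
  P = Pow k seeds

  module _ {e : Fin C} {x : List (Fin C)} (lx : length x ≡ n) where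

    cell-dominated : ∀ {p q} → P 0 (node (e ∷ x) p q)
    cell-dominated with chosen-nonempty e
    ... | d , d∈ = _ , ∈-seeds d∈ lx {s≤s z≤n} {child-fits lx} , inj₂ parent

    child-dominated : ∀ a {p q} → P 0 (node (a ∷ e ∷ x) p q)
    child-dominated a with chosen-nonempty e
    ... | d , d∈ with d ≟ᶠ a
    ...   | yes refl = _ , ∈-seeds d∈ lx , inj₁ refl
    ...   | no d≢a = _ , ∈-seeds d∈ lx {s≤s z≤n} {child-fits lx} , inj₂ (sibling d≢a)

    seed-child-dominated : ∀ {d} → d ∈ chosen e → ∀ b {p q} → P 0 (node (b ∷ d ∷ e ∷ x) p q)
    seed-child-dominated d∈ b = _ , ∈-seeds d∈ lx {s≤s z≤n} {child-fits lx} , inj₂ child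

  dominated-cell-level : ∀ {w p q} → length w ≡ suc n → P 0 (node w p q)
  dominated-cell-level {[]} ()
  dominated-cell-level {e ∷ x} lw = cell-dominated (suc-injective lw)

  dominated-child-level : ∀ {w p q} → length w ≡ 2 + n → P 0 (node w p q)
  dominated-child-level {[]} ()
  dominated-child-level {_ ∷ []} ()
  dominated-child-level {a ∷ e ∷ x} lw = child-dominated (suc-injective (suc-injective lw)) a

  module _ {e : Fin C} {x : List (Fin C)} (lx : length x ≡ n) where

    leaves-forced : ∀ i a →
      (∀ c → c ∈ chosen e ⊎ c ≡ next e → ∀ {p q} → P i (node (c ∷ a ∷ e ∷ x) p q)) →
      ∀ b {p q} → P (suc i) (node (b ∷ a ∷ e ∷ x) p q)
    leaves-forced i a known b =
      forces i (map leaf (rest e)) length-rest-leaves (Pow-mono i z≤n (child-dominated lx a))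
        others (inj₂ child)
      where
      leaf : Fin C → Vertex C L
      leaf c = node (c ∷ a ∷ e ∷ x) (s≤s z≤n) (≤-reflexive (cong (3 +_) lx))
      length-rest-leaves : length (map leaf (rest e)) ≤ k
      length-rest-leaves = ≤-trans (≤-reflexive (length-map leaf (rest e))) (length-rest e)
      others : ∀ {w} → Adj (node (a ∷ e ∷ x) (s≤s z≤n) (child-fits lx)) w → P i w ⊎ w ∈ map leaf (rest e)
      others u~w with neighbour u~w
      ... | nbr-apex ()
      ... | nbr-sibling refl = inj₁ (Pow-mono i z≤n (child-dominated lx _))
      ... | nbr-swap {m} _ eq =
              inj₁ (Pow-mono i z≤n (dominated-child-level (trans (length-swap (suc m) eq) (cong (2 +_) lx))))
      ... | nbr-parent refl = inj₁ (Pow-mono i z≤n (cell-dominated lx))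
      ... | nbr-child {b = c} with cover e c
      ...   | inj₁ c∈ = inj₁ (known c (inj₁ c∈))
      ...   | inj₂ (inj₁ c≡) = inj₁ (known c (inj₂ c≡))
      ...   | inj₂ (inj₂ c∈) = inj₂ (subst (_∈ map leaf (rest e)) (node-≡ refl) (∈-map⁺ leaf c∈))

    leaf-chosen : ∀ {d} → d ∈ chosen e → ∀ a {p q} → P 1 (node (d ∷ a ∷ e ∷ x) p q)
    leaf-chosen {d} d∈ a with a ≟ᶠ d
    ... | yes refl = Pow-suc 0 (seed-child-dominated lx d∈ d)
    ... | no a≢d =
            swap-forced 1≤k 0 0 a≢d (cong (3 +_) lx) (seed-child-dominated lx d∈) (child-dominated lx d)

    leaf-next-next : ∀ {p q} → P 1 (node (next e ∷ next e ∷ e ∷ x) p q)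
    leaf-next-next =
      swap-forced 1≤k 0 1 (≢-next e) (cong (3 +_) lx)
        (seed-child-dominated lx (∈-chosen-next e)) (child-dominated lx e)

    leaves-below-next : ∀ b {p q} → P 2 (node (b ∷ next e ∷ e ∷ x) p q)
    leaves-below-next = leaves-forced 1 (next e) known
      where
      known : ∀ c → c ∈ chosen e ⊎ c ≡ next e → ∀ {p q} → P 1 (node (c ∷ next e ∷ e ∷ x) p q)
      known c (inj₁ c∈) = leaf-chosen c∈ (next e)
      known c (inj₂ refl) = leaf-next-next

    leaf-next : ∀ a {p q} → P 3 (node (next e ∷ a ∷ e ∷ x) p q)
    leaf-next a with a ≟ᶠ next e
    ... | yes refl = Pow-mono 3 (s≤s z≤n) leaf-next-next
    ... | no a≢next = swap-forced 1≤k 2 0 a≢next (cong (3 +_) lx) leaves-below-next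
                        (Pow-mono 2 z≤n (child-dominated lx (next e)))

    leaves : ∀ a b {p q} → P 4 (node (b ∷ a ∷ e ∷ x) p q)
    leaves a = leaves-forced 3 a known
      where
      known : ∀ c → c ∈ chosen e ⊎ c ≡ next e → ∀ {p q} → P 3 (node (c ∷ a ∷ e ∷ x) p q)
      known c (inj₁ c∈) = Pow-mono 3 (s≤s z≤n) (leaf-chosen c∈ a)
      known c (inj₂ refl) = leaf-next a

  leaf-level : ∀ {w p q} → length w ≡ L → P 4 (node w p q)
  leaf-level {[]} ()
  leaf-level {_ ∷ []} ()
  leaf-level {_ ∷ _ ∷ []} ()
  leaf-level {b ∷ a ∷ e ∷ x} lw = leaves (+-cancelˡ-≡ 3 _ _ lw) a b

  near-leaves : ∀ {w p q} → suc n ≤ length w → P 4 (node w p q)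
  near-leaves {q = q} n<w with m≤n⇒m<n∨m≡n q
  ... | inj₂ w≡L = leaf-level w≡L
  ... | inj₁ (s≤s w≤2+n) with m≤n⇒m<n∨m≡n w≤2+n
  ...   | inj₁ (s≤s w≤1+n) = Pow-mono 4 z≤n (dominated-cell-level (≤-antisym w≤1+n n<w))
  ...   | inj₂ w≡2+n = Pow-mono 4 z≤n (dominated-child-level w≡2+n)

  seeds-isKPDS : Fin C → IsKPDS C L k seeds
  seeds-isKPDS z = suc (n + 4) , λ
    { apex → apex-forced 1≤k (n + 4) z (s≤s z≤n) all-nodes
    ; (node w p q) → Pow-suc (n + 4) all-nodes
    }
    where
    all-nodes : ∀ {w p q} → P (n + 4) (node w p q)
    all-nodes {p = p} = climbs 1≤k n 4 (n≤1+n _) near-leaves p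

module Modular (C : ℕ) .{{_ : NonZero C}} where

  infixl 6 _⊕_
  _⊕_ : Fin C → ℕ → Fin C
  e ⊕ j = (toℕ e + j) mod C

  toℕ-⊕ : ∀ e j → toℕ (e ⊕ j) ≡ (toℕ e + j) % C
  toℕ-⊕ e j = toℕ-fromℕ< (m%n<n (toℕ e + j) C)

  [m%C+o]%C≡[m+o]%C : ∀ m o → (m % C + o) % C ≡ (m + o) % C
  [m%C+o]%C≡[m+o]%C m o = begin
    (m % C + o) % C           ≡⟨ %-distribˡ-+ (m % C) o C ⟩
    (m % C % C + o % C) % C   ≡⟨ cong (λ r → (r + o % C) % C) (m%n%n≡m%n m C) ⟩
    (m % C + o % C) % C       ≡⟨ %-distribˡ-+ m o C ⟨
    (m + o) % C               ∎
    where open ≡-Reasoning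

  toℕ%C≡toℕ : ∀ e → toℕ e % C ≡ toℕ e
  toℕ%C≡toℕ e = m<n⇒m%n≡m (toℕ<n e)

  ⊕-identityʳ : ∀ e → e ⊕ 0 ≡ e
  ⊕-identityʳ e = toℕ-injective (begin
    toℕ (e ⊕ 0)      ≡⟨ toℕ-⊕ e 0 ⟩
    (toℕ e + 0) % C  ≡⟨ cong (_% C) (+-identityʳ (toℕ e)) ⟩
    toℕ e % C        ≡⟨ toℕ%C≡toℕ e ⟩
    toℕ e            ∎)
    where open ≡-Reasoning

  ⊕-cycle : ∀ e → e ⊕ C ≡ e
  ⊕-cycle e = toℕ-injective (begin
    toℕ (e ⊕ C)      ≡⟨ toℕ-⊕ e C ⟩
    (toℕ e + C) % C  ≡⟨ [m+n]%n≡m%n (toℕ e) C ⟩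
    toℕ e % C        ≡⟨ toℕ%C≡toℕ e ⟩
    toℕ e            ∎)
    where open ≡-Reasoning

  ⊕-assoc : ∀ e i j → e ⊕ i ⊕ j ≡ e ⊕ (i + j)
  ⊕-assoc e i j = toℕ-injective (begin
    toℕ (e ⊕ i ⊕ j)              ≡⟨ toℕ-⊕ (e ⊕ i) j ⟩
    (toℕ (e ⊕ i) + j) % C        ≡⟨ cong (λ r → (r + j) % C) (toℕ-⊕ e i) ⟩
    ((toℕ e + i) % C + j) % C    ≡⟨ [m%C+o]%C≡[m+o]%C (toℕ e + i) j ⟩
    (toℕ e + i + j) % C          ≡⟨ cong (_% C) (+-assoc (toℕ e) i j) ⟩
    (toℕ e + (i + j)) % C        ≡⟨ toℕ-⊕ e (i + j) ⟨
    toℕ (e ⊕ (i + j))            ∎)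
    where open ≡-Reasoning

  ⊕-surjective : ∀ e c → ∃[ j ] (j < C × e ⊕ j ≡ c)
  ⊕-surjective e c = j , m%n<n _ C , toℕ-injective (begin
    toℕ (e ⊕ j)                      ≡⟨ toℕ-⊕ e j ⟩
    (toℕ e + j) % C                  ≡⟨ cong (_% C) (+-comm (toℕ e) j) ⟩
    (j + toℕ e) % C                  ≡⟨ [m%C+o]%C≡[m+o]%C (toℕ c + (C ∸ toℕ e)) (toℕ e) ⟩
    (toℕ c + (C ∸ toℕ e) + toℕ e) % C  ≡⟨ cong (_% C) (+-assoc (toℕ c) _ _) ⟩
    (toℕ c + (C ∸ toℕ e + toℕ e)) % C  ≡⟨ cong (λ r → (toℕ c + r) % C) (m∸n+n≡m (<⇒≤ (toℕ<n e))) ⟩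
    (toℕ c + C) % C                  ≡⟨ [m+n]%n≡m%n (toℕ c) C ⟩
    toℕ c % C                        ≡⟨ toℕ%C≡toℕ c ⟩
    toℕ c                            ∎)
    where
    open ≡-Reasoning
    j = (toℕ c + (C ∸ toℕ e)) % C

  ≢-⊕1 : 2 ≤ C → ∀ e → e ≢ e ⊕ 1
  ≢-⊕1 2≤C e e≡e⊕1 =
    no-fixpoint (toℕ<n e) (trans (cong toℕ e≡e⊕1) (trans (toℕ-⊕ e 1) (cong (_% C) (+-comm (toℕ e) 1))))
    where
    no-fixpoint : ∀ {m} → m < C → m ≢ suc m % C
    no-fixpoint {m} m<C m≡ with m≤n⇒m<n∨m≡n m<C
    ... | inj₁ 1+m<C = 1+n≢n (sym (trans m≡ (m<n⇒m%n≡m 1+m<C)))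
    ... | inj₂ 1+m≡C = contradiction (subst (1 ≤_) m≡0 (≤-pred (subst (2 ≤_) (sym 1+m≡C) 2≤C))) λ ()
      where
      m≡0 : m ≡ 0
      m≡0 = trans m≡ (trans (cong (_% C) 1+m≡C) (n%n≡0 C))

-- Offsets from e (with k = suc k′): 1 is next e, k+1, …, C−1 are chosen, and 0, 2, …, k form rest e.
cyclicPattern : ∀ k t → 1 ≤ k → 1 ≤ t → Pattern (suc (k + t)) k t
cyclicPattern (suc k′) (suc t′) _ _ = record
  { next            = _⊕ 1
  ; chosen          = chosen
  ; rest            = rest
  ; ≢-next          = ≢-⊕1 (s≤s (s≤s z≤n))
  ; ∈-chosen-next   = ∈-chosen-next
  ; chosen-nonempty = λ e → _ , ∈-applyUpTo⁺ (chosen-digit e) (s≤s z≤n)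
  ; length-chosen   = λ e → length-applyUpTo (chosen-digit e) (suc t′)
  ; length-rest     = λ e → ≤-reflexive (cong suc (length-applyUpTo (rest-digit e) k′))
  ; cover           = cover
  }
  where
  C : ℕ
  C = suc (suc k′ + suc t′)
  open Modular C

  chosen-digit rest-digit : Fin C → ℕ → Fin C
  chosen-digit e i = e ⊕ (suc (suc k′) + i)
  rest-digit e i = e ⊕ (2 + i)

  chosen rest : Fin C → List (Fin C)
  chosen e = applyUpTo (chosen-digit e) (suc t′)
  rest e = e ∷ applyUpTo (rest-digit e) k′

  ∈-chosen-next : ∀ e → e ∈ chosen (e ⊕ 1)
  ∈-chosen-next e = subst (_∈ chosen (e ⊕ 1)) back (∈-applyUpTo⁺ (chosen-digit (e ⊕ 1)) ≤-refl)
    where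
    open ≡-Reasoning
    back : e ⊕ 1 ⊕ (suc (suc k′) + t′) ≡ e
    back = begin
      e ⊕ 1 ⊕ (suc (suc k′) + t′)    ≡⟨ ⊕-assoc e 1 _ ⟩
      e ⊕ suc (suc (suc (k′ + t′)))  ≡⟨ cong (λ j → e ⊕ suc (suc j)) (+-suc k′ t′) ⟨
      e ⊕ C                          ≡⟨ ⊕-cycle e ⟩
      e                              ∎

  cover : ∀ e c → c ∈ chosen e ⊎ c ≡ e ⊕ 1 ⊎ c ∈ rest e
  cover e c with ⊕-surjective e c
  ... | zero , _ , refl = inj₂ (inj₂ (here (⊕-identityʳ e)))
  ... | suc zero , _ , refl = inj₂ (inj₁ refl)
  ... | suc (suc i) , s≤s (s≤s i<k′+t) , refl with i <? k′
  ...   | yes i<k′ = inj₂ (inj₂ (there (∈-applyUpTo⁺ (rest-digit e) i<k′)))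
  ...   | no i≮k′ = inj₁ (subst (_∈ chosen e) (cong (λ j → e ⊕ suc (suc j)) (m+[n∸m]≡n (≮⇒≥ i≮k′)))
                             (∈-applyUpTo⁺ (chosen-digit e) (m<n+o⇒m∸n<o i k′ i<k′+t)))

complement-positive : ∀ k {C} → suc k < C → 1 ≤ C ∸ k ∸ 1
complement-positive zero (s≤s (s≤s _)) = s≤s z≤n
complement-positive (suc k) (s≤s k+1<C) = complement-positive k k+1<C

complement-sum : ∀ k {C} → k < C → suc (k + (C ∸ k ∸ 1)) ≡ C
complement-sum zero (s≤s _) = refl
complement-sum (suc k) (s≤s k<C) = cong suc (complement-sum k k<C)

mainTheorem5 : ∀ (C L k : ℕ) → 3 ≤ C → 3 ≤ L → 1 ≤ k → k ≤ C ∸ 2 →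
    ∃[ S ] (length {A = Vertex C L} S ≤ (C ∸ k ∸ 1) * C ^ (L ∸ 2) × IsKPDS C L k S)
mainTheorem5 C L k 3≤C (s≤s (s≤s (s≤s {n = n} _))) 1≤k k≤C∸2 =
  seeds , ≤-reflexive (trans length-seeds (*-comm (C ^ suc n) t)) ,
  seeds-isKPDS (fromℕ< (≤-trans (s≤s z≤n) 3≤C))
  where
  t : ℕ
  t = C ∸ k ∸ 1

  k+1<C : suc k < C
  k+1<C = subst (_≤ C) (+-comm k 2) (m≤o∸n⇒m+n≤o k (≤-trans (n≤1+n 2) 3≤C) k≤C∸2)

  π : Pattern C k t
  π = subst (λ C′ → Pattern C′ k t) (complement-sum k (<⇒≤ k+1<C))
        (cyclicPattern k t 1≤k (complement-positive k k+1<C))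

  open Seeding π 1≤k n
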